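{- Let $G$ be a quasi $5$-connected graph with $|V(G)|\geq 14$. Let $x$ be a vertex of degree $4$ with $N_{G}(x)=\{x_{1},x_{2},x_{3},x_{4}\}$ such that the subgraph induced by $N_{G}(x)$ is the star with edges $x_{1}x_{4},x_{2}x_{4},x_{3}x_{4}$. Suppose moreover that $x_{3}$ has degree $4$ with $N_{G}(x_{3})=\{x,x_{4},a,b\}$ and $ab\in E(G)$. Then $G/xx_{3}$ is quasi $5$-connected.
   Context: All graphs are finite, simple and undirected. A cut of a connected graph $G$ is a set $T\subseteq V(G)$ such that $G-T$ is disconnected; a $k$-cut is a cut with $k$ elements. A $k$-cut $T$ is nontrivial if the components of $G-T$ can be partitioned into two subgraphs $G_{1},G_{2}$ with $|V(G_{1})|\geq 2$ and $|V(G_{2})|\geq 2$. A graph is quasi $k$-connected if it is $(k-1)$-connected and has no nontrivial $(k-1)$-cut. $G/xx_{3}$ is obtained by deleting the edge $xx_{3}$, identifying $x$ and $x_{3}$, and replacing multiple edges by single edges. -}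

module Defs where

open import Data.Nat using (ℕ; suc; _<_; _≤_; _∸_)
open import Data.Fin using (Fin; punchIn)
open import Data.Fin.Subset using (Subset; _∈_; _∉_; ∣_∣)
open import Data.Product using (Σ; _×_; _,_; ∃; ∃-syntax)
open import Data.Sum using (_⊎_; inj₁; inj₂)
open import Relation.Nullary using (¬_)
open import Relation.Binary.PropositionalEquality using (_≡_; _≢_; refl; sym)

record Graph (n : ℕ) : Set₁ where
  field
    _~_    : Fin n → Fin n → Set
    ~-sym  : ∀ {u v} → u ~ v → v ~ u
    ~-irr  : ∀ {u} → ¬ (u ~ u)
open Graph public

module _ {n : ℕ} (G : Graph n) where
  data Reach (T : Subset n) : Fin n → Fin n → Set where
    here : ∀ {u} → u ∉ T → Reach T u u
    step : ∀ {u v w} → u ∉ T → _~_ G u v → Reach T v w → Reach T u w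

  Disconnected : Subset n → Set
  Disconnected T = ∃[ u ] ∃[ v ] (u ∉ T × v ∉ T × ¬ Reach T u v)

  IsCut : Subset n → Set
  IsCut T = Disconnected T

  KConnected : ℕ → Set
  KConnected k = k < n × (∀ (T : Subset n) → ∣ T ∣ < k → ¬ IsCut T)

  -- T is a nontrivial cut: the components of G - T split into two parts
  -- A, B (unions of components: partition of V - T with no A-B edges),
  -- each with at least 2 vertices
  NontrivialCut : Subset n → Set
  NontrivialCut T =
    IsCut T ×
    Σ (Subset n) λ A → Σ (Subset n) λ B →
      (∀ v → v ∉ T → v ∈ A ⊎ v ∈ B) ×
      (∀ v → v ∈ A → v ∉ T) ×
      (∀ v → v ∈ B → v ∉ T) ×
      (∀ v → v ∈ A → v ∉ B) ×
      (∀ u v → u ∈ A → v ∈ B → ¬ (_~_ G u v)) ×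
      2 ≤ ∣ A ∣ × 2 ≤ ∣ B ∣

  QuasiConnected : ℕ → Set
  QuasiConnected k =
    KConnected (k ∸ 1) × (∀ (T : Subset n) → ∣ T ∣ ≡ k ∸ 1 → ¬ NontrivialCut T)

-- Contraction G / x y : delete edge xy, identify x and y (the merged vertex
-- is x; y is removed), drop multiple edges. Vertices of the result are
-- Fin m, vertex i standing for  punchIn y i  of G (all vertices except y).
contract : ∀ {m} → Graph (suc m) → (x y : Fin (suc m)) → Graph m
contract {m} G x y = record { _~_ = E ; ~-sym = s ; ~-irr = irr }
  where
    _≈_ = _~_ G
    E : Fin m → Fin m → Set
    E i j = i ≢ j ×
      ( (punchIn y i ≈ punchIn y j)
      ⊎ ((punchIn y i ≡ x × y ≈ punchIn y j)
      ⊎ (punchIn y j ≡ x × y ≈ punchIn y i)))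
    s : ∀ {i j} → E i j → E j i
    s (ne , inj₁ e) = (λ eq → ne (sym eq)) , inj₁ (~-sym G e)
    s (ne , inj₂ (inj₁ p)) = (λ eq → ne (sym eq)) , inj₂ (inj₂ p)
    s (ne , inj₂ (inj₂ p)) = (λ eq → ne (sym eq)) , inj₂ (inj₁ p)
    irr : ∀ {i} → ¬ E i i
    irr (ne , _) = ne refl

{-# OPTIONS --safe #-}
module Submission where

-- Lift a small or nontrivial cut T′ of G/xx₃ to G by splitting the merged vertex. If the merged
-- vertex is not in T′ the lift is a cut of the same kind in G. Otherwise the lift T contains x and
-- x₃ and has one vertex more, so by the connectivity of G neither T - x nor T - x₃ is a cut of
-- that kind, which forces both x and x₃ to have neighbours in two different components of G - T.
-- That is impossible: if x₄ ∉ T every neighbour of x outside T is joined to x₄, and if x₄ ∈ T the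
-- neighbours of x₃ outside T lie on the edge ab.

open import Defs
open import Data.Bool.Properties using (¬-not)
open import Data.Empty using (⊥; ⊥-elim)
open import Data.Fin using (Fin; punchIn; punchOut; _≟_)
open import Data.Fin.Properties using (punchIn-punchOut; punchIn-injective; punchInᵢ≢i)
open import Data.Fin.Subset
  using (Subset; Side; inside; outside; _∈_; _∉_; ∣_∣; _-_; _∪_; ⁅_⁆; Nonempty)
open import Data.Fin.Subset.Properties
  using (_∈?_; nonempty?; Empty-unique; ∣⊥∣≡0; ∣p∣≤∣x∷p∣; ∣p∣≤∣p∪q∣; p─⊥≡p; p─q⊆p;
         x∈p∧x≢y⇒x∈p-y; x∈p∪q⁺; x∈p∪q⁻; x∈⁅x⁆; x∈⁅y⁆⇒x≡y)
open import Data.List using (List; []; _∷_)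
open import Data.List.Membership.Propositional using (find; lose) renaming (_∈_ to _∈ₗ_)
open import Data.List.Relation.Unary.All as All using (All; []; _∷_)
open import Data.List.Relation.Unary.Any using (here; there; any?)
open import Data.Nat using (ℕ; suc; _≤_; _<_; s≤s⁻¹)
open import Data.Nat.Properties using (≤-trans; <⇒≤; >⇒≢; m≤n+m; suc-injective)
open import Data.Product using (∃; ∃₂; _×_; _,_)
open import Data.Sum using (_⊎_; inj₁; inj₂; swap) renaming (map to map⊎)
open import Data.Vec using (_∷_; lookup; insertAt; here; there)
open import Data.Vec.Properties using ([]=⇒lookup; lookup⇒[]=; insertAt-lookup; insertAt-punchIn)
open import Function using (_∘_; id)
open import Relation.Nullary using (¬_; yes; no; contradiction)
open import Relation.Binary.PropositionalEquality
  using (_≡_; _≢_; refl; sym; trans; cong; subst; subst₂; module ≡-Reasoning)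

∣p∣≥1⇒Nonempty : ∀ {k} {p : Subset k} → 1 ≤ ∣ p ∣ → Nonempty p
∣p∣≥1⇒Nonempty {k} {p} 1≤∣p∣ with nonempty? p
... | yes p≢∅ = p≢∅
... | no p≡∅ = contradiction (trans (cong ∣_∣ (Empty-unique p≡∅)) (∣⊥∣≡0 k)) (>⇒≢ 1≤∣p∣)

x∈p⇒suc∣p-x∣≡∣p∣ : ∀ {k} {p : Subset k} {x} → x ∈ p → suc ∣ p - x ∣ ≡ ∣ p ∣
x∈p⇒suc∣p-x∣≡∣p∣ {p = inside ∷ p} here = cong (suc ∘ ∣_∣) (p─⊥≡p p)
x∈p⇒suc∣p-x∣≡∣p∣ {p = inside ∷ p} (there x∈p) = cong suc (x∈p⇒suc∣p-x∣≡∣p∣ x∈p)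
x∈p⇒suc∣p-x∣≡∣p∣ {p = outside ∷ p} (there x∈p) = x∈p⇒suc∣p-x∣≡∣p∣ x∈p

x∉p-x : ∀ {k} {p : Subset k} x → x ∉ p - x
x∉p-x {p = _ ∷ p} Fin.zero ()
x∉p-x {p = _ ∷ p} (Fin.suc x) (there x∈p-x) = x∉p-x x x∈p-x

x∉p⇒x∉p-y : ∀ {k} {p : Subset k} {x y} → x ∉ p → x ∉ p - y
x∉p⇒x∉p-y {p = p} {y = y} x∉p = x∉p ∘ p─q⊆p p ⁅ y ⁆

x∉p-y⇒x∉p : ∀ {k} {p : Subset k} {x y} → x ≢ y → x ∉ p - y → x ∉ p
x∉p-y⇒x∉p x≢y x∉p-y x∈p = x∉p-y (x∈p∧x≢y⇒x∈p-y x∈p x≢y)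

∣insertAt∣ : ∀ {k} (p : Subset k) i (s : Side) → ∣ insertAt p i s ∣ ≡ ∣ s ∷ p ∣
∣insertAt∣ p Fin.zero s = refl
∣insertAt∣ (inside ∷ p) (Fin.suc i) inside = cong suc (∣insertAt∣ p i inside)
∣insertAt∣ (inside ∷ p) (Fin.suc i) outside = cong suc (∣insertAt∣ p i outside)
∣insertAt∣ (outside ∷ p) (Fin.suc i) inside = ∣insertAt∣ p i inside
∣insertAt∣ (outside ∷ p) (Fin.suc i) outside = ∣insertAt∣ p i outside

-- Components of G - T

module _ {n : ℕ} (G : Graph n) where

  private
    _∼_ : Fin n → Fin n → Set
    _∼_ = _~_ G

  module _ {T : Subset n} where

    reach-start : ∀ {u v} → Reach G T u v → u ∉ T
    reach-start (here u∉T) = u∉T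
    reach-start (step u∉T _ _) = u∉T

    reach-end : ∀ {u v} → Reach G T u v → v ∉ T
    reach-end (here v∉T) = v∉T
    reach-end (step _ _ r) = reach-end r

    reach-++ : ∀ {u v w} → Reach G T u v → Reach G T v w → Reach G T u w
    reach-++ (here _) r = r
    reach-++ (step u∉T u∼v r) r′ = step u∉T u∼v (reach-++ r r′)

    reach-sym : ∀ {u v} → Reach G T u v → Reach G T v u
    reach-sym (here u∉T) = here u∉T
    reach-sym (step u∉T u∼v r) =
      reach-++ (reach-sym r) (step (reach-start r) (~-sym G u∼v) (here u∉T))

  Straddles : Subset n → Fin n → Set
  Straddles T y = ∃₂ λ p q → y ∼ p × y ∼ q × p ∉ T × q ∉ T × ¬ Reach G T p q

  leaves-through : ∀ {T y s u v} → Reach G T s u → Reach G (T - y) u v → ¬ Reach G T s v →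
         ∃ λ p → y ∼ p × Reach G T s p
  leaves-through s⇝u (here _) ¬s⇝v = contradiction s⇝u ¬s⇝v
  leaves-through {y = y} {u = u} s⇝u (step {v = w} _ u∼w w⇝v) ¬s⇝v with w ≟ y
  ... | yes refl = u , ~-sym G u∼w , s⇝u
  ... | no w≢y = leaves-through (reach-++ s⇝u (step (reach-end s⇝u) u∼w (here w∉T))) w⇝v ¬s⇝v
    where w∉T = x∉p-y⇒x∉p w≢y (reach-start w⇝v)

  bypass⇒Straddles : ∀ {T y u v} → u ∉ T → v ∉ T → ¬ Reach G T u v → Reach G (T - y) u v →
                     Straddles T y
  bypass⇒Straddles u∉T v∉T ¬u⇝v u⇝v
    with leaves-through (here u∉T) u⇝v ¬u⇝v
       | leaves-through (here v∉T) (reach-sym u⇝v) (¬u⇝v ∘ reach-sym)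
  ... | p , y∼p , u⇝p | q , y∼q , v⇝q =
    p , q , y∼p , y∼q , reach-end u⇝p , reach-end v⇝q ,
    λ p⇝q → ¬u⇝v (reach-++ u⇝p (reach-++ p⇝q (reach-sym v⇝q)))

  minimal-cut⇒¬¬Straddles : ∀ {T y} → IsCut G T → ¬ IsCut G (T - y) → ¬ ¬ Straddles T y
  minimal-cut⇒¬¬Straddles (u , v , u∉T , v∉T , ¬u⇝v) ¬cut ¬straddles =
    ¬cut (u , v , x∉p⇒x∉p-y u∉T , x∉p⇒x∉p-y v∉T , ¬straddles ∘ bypass⇒Straddles u∉T v∉T ¬u⇝v)

  hub⇒¬Straddles : ∀ {T y} w → (∀ {p} → y ∼ p → p ∉ T → Reach G T p w) → ¬ Straddles T y
  hub⇒¬Straddles w hub (p , q , y∼p , y∼q , p∉T , q∉T , ¬p⇝q) =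
    ¬p⇝q (reach-++ (hub y∼p p∉T) (reach-sym (hub y∼q q∉T)))

  clique⇒¬Straddles : ∀ {T y} → (∀ {p q} → y ∼ p → y ∼ q → p ∉ T → q ∉ T → p ≡ q ⊎ p ∼ q) →
                      ¬ Straddles T y
  clique⇒¬Straddles clique (p , q , y∼p , y∼q , p∉T , q∉T , ¬p⇝q) with clique y∼p y∼q p∉T q∉T
  ... | inj₁ refl = ¬p⇝q (here p∉T)
  ... | inj₂ p∼q = ¬p⇝q (step p∉T p∼q (here q∉T))

  record Separation (T A B : Subset n) : Set where
    constructor mkSeparation
    field
      cover      : ∀ v → v ∉ T → v ∈ A ⊎ v ∈ B
      A-avoids-T : ∀ v → v ∈ A → v ∉ T
      B-avoids-T : ∀ v → v ∈ B → v ∉ T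
      disjoint   : ∀ v → v ∈ A → v ∉ B
      no-edge    : ∀ u v → u ∈ A → v ∈ B → ¬ (u ∼ v)
      2≤∣A∣      : 2 ≤ ∣ A ∣
      2≤∣B∣      : 2 ≤ ∣ B ∣

  NontrivialCut⇒Separation : ∀ {T} → NontrivialCut G T → ∃₂ (Separation T)
  NontrivialCut⇒Separation (_ , A , B , cover , A-T , B-T , disjoint , no-edge , 2≤∣A∣ , 2≤∣B∣) =
    A , B , mkSeparation cover A-T B-T disjoint no-edge 2≤∣A∣ 2≤∣B∣

  module _ {T A B : Subset n} (sep : Separation T A B) where
    open Separation sep

    separation-¬reach : ∀ {u v} → u ∈ A → v ∈ B → ¬ Reach G T u v
    separation-¬reach u∈A v∈B (here _) = disjoint _ u∈A v∈B
    separation-¬reach u∈A v∈B (step _ u∼w w⇝v) with cover _ (reach-start w⇝v)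
    ... | inj₁ w∈A = separation-¬reach w∈A v∈B w⇝v
    ... | inj₂ w∈B = no-edge _ _ u∈A w∈B u∼w

    Separation⇒NontrivialCut : NontrivialCut G T
    Separation⇒NontrivialCut with ∣p∣≥1⇒Nonempty (<⇒≤ 2≤∣A∣) | ∣p∣≥1⇒Nonempty (<⇒≤ 2≤∣B∣)
    ... | u , u∈A | v , v∈B =
      (u , v , A-avoids-T u u∈A , B-avoids-T v v∈B , separation-¬reach u∈A v∈B) ,
      A , B , cover , A-avoids-T , B-avoids-T , disjoint , no-edge , 2≤∣A∣ , 2≤∣B∣

    Separation-swap : Separation T B A
    Separation-swap = mkSeparation
      (λ v → swap ∘ cover v) B-avoids-T A-avoids-T
      (λ v v∈B v∈A → disjoint v v∈A v∈B)
      (λ u v u∈B v∈A → no-edge v u v∈A u∈B ∘ ~-sym G)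
      2≤∣B∣ 2≤∣A∣

    absorb : ∀ {y} → y ∈ T → (∀ {v} → y ∼ v → v ∉ B) → Separation (T - y) (A ∪ ⁅ y ⁆) B
    absorb {y} y∈T y↛B = mkSeparation cover′ A′-avoids-T (λ v → x∉p⇒x∉p-y ∘ B-avoids-T v)
      disjoint′ no-edge′ (≤-trans 2≤∣A∣ (∣p∣≤∣p∪q∣ A ⁅ y ⁆)) 2≤∣B∣
      where
      A′⇒A⊎y : ∀ {v} → v ∈ A ∪ ⁅ y ⁆ → v ∈ A ⊎ v ≡ y
      A′⇒A⊎y = map⊎ id (x∈⁅y⁆⇒x≡y y) ∘ x∈p∪q⁻ A ⁅ y ⁆

      cover′ : ∀ v → v ∉ T - y → v ∈ A ∪ ⁅ y ⁆ ⊎ v ∈ B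
      cover′ v v∉T-y with v ≟ y
      ... | yes refl = inj₁ (x∈p∪q⁺ (inj₂ (x∈⁅x⁆ y)))
      ... | no v≢y = map⊎ (x∈p∪q⁺ ∘ inj₁) id (cover v (x∉p-y⇒x∉p v≢y v∉T-y))

      A′-avoids-T : ∀ v → v ∈ A ∪ ⁅ y ⁆ → v ∉ T - y
      A′-avoids-T v v∈A′ with A′⇒A⊎y v∈A′
      ... | inj₁ v∈A = x∉p⇒x∉p-y (A-avoids-T v v∈A)
      ... | inj₂ refl = x∉p-x y

      disjoint′ : ∀ v → v ∈ A ∪ ⁅ y ⁆ → v ∉ B
      disjoint′ v v∈A′ with A′⇒A⊎y v∈A′
      ... | inj₁ v∈A = disjoint v v∈A
      ... | inj₂ refl = λ y∈B → B-avoids-T y y∈B y∈T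

      no-edge′ : ∀ u v → u ∈ A ∪ ⁅ y ⁆ → v ∈ B → ¬ (u ∼ v)
      no-edge′ u v u∈A′ v∈B with A′⇒A⊎y u∈A′
      ... | inj₁ u∈A = no-edge u v u∈A v∈B
      ... | inj₂ refl = λ y∼v → y↛B y∼v v∈B

  Neighbourhood : Fin n → List (Fin n) → Set
  Neighbourhood y ns = (∀ {v} → y ∼ v → v ∈ₗ ns) × All (y ∼_) ns

  neighbour-in? : ∀ {y ns} → Neighbourhood y ns → (S : Subset n) →
                  (∃ λ v → y ∼ v × v ∈ S) ⊎ (∀ {v} → y ∼ v → v ∉ S)
  neighbour-in? {ns = ns} (complete , sound) S with any? (_∈? S) ns
  ... | yes some = let v , v∈ns , v∈S = find some in inj₁ (v , All.lookup sound v∈ns , v∈S)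
  ... | no none = inj₂ λ y∼v v∈S → none (lose (complete y∼v) v∈S)

  Separation⇒Straddles : ∀ {T A B y ns} → Separation T A B → Neighbourhood y ns → y ∈ T →
                         ¬ NontrivialCut G (T - y) → Straddles T y
  Separation⇒Straddles {A = A} {B} sep N y∈T ¬nontrivial with neighbour-in? N A | neighbour-in? N B
  ... | inj₂ y↛A | _ =
    ⊥-elim (¬nontrivial (Separation⇒NontrivialCut (absorb (Separation-swap sep) y∈T y↛A)))
  ... | inj₁ _ | inj₂ y↛B = ⊥-elim (¬nontrivial (Separation⇒NontrivialCut (absorb sep y∈T y↛B)))
  ... | inj₁ (p , y∼p , p∈A) | inj₁ (q , y∼q , q∈B) =
    p , q , y∼p , y∼q , A-avoids-T p p∈A , B-avoids-T q q∈B , separation-¬reach sep p∈A q∈B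
    where open Separation sep

-- Lifting cuts of a contraction

module Contraction {m : ℕ} (G : Graph (suc m)) (x y : Fin (suc m)) (y≢x : y ≢ x) where

  private
    _∼_ : Fin (suc m) → Fin (suc m) → Set
    _∼_ = _~_ G
    G/xy : Graph m
    G/xy = contract G x y

  x′ : Fin m
  x′ = punchOut y≢x

  merge : Fin (suc m) → Fin m
  merge z with y ≟ z
  ... | yes _ = x′
  ... | no y≢z = punchOut y≢z

  merge-y : merge y ≡ x′
  merge-y with y ≟ y
  ... | yes _ = refl
  ... | no y≢y = contradiction refl y≢y

  punchIn-merge-y : punchIn y (merge y) ≡ x
  punchIn-merge-y = trans (cong (punchIn y) merge-y) (punchIn-punchOut y≢x)

  punchIn-merge : ∀ z → z ≡ y ⊎ punchIn y (merge z) ≡ z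
  punchIn-merge z with y ≟ z
  ... | yes y≡z = inj₁ (sym y≡z)
  ... | no y≢z = inj₂ (punchIn-punchOut y≢z)

  merge-x : merge x ≡ x′
  merge-x with punchIn-merge x
  ... | inj₁ x≡y = contradiction (sym x≡y) y≢x
  ... | inj₂ eq = punchIn-injective y _ _ (trans eq (sym (punchIn-punchOut y≢x)))

  merge-punchIn : ∀ i → merge (punchIn y i) ≡ i
  merge-punchIn i with punchIn-merge (punchIn y i)
  ... | inj₁ eq = contradiction eq (punchInᵢ≢i y i)
  ... | inj₂ eq = punchIn-injective y _ _ eq

  merge-edge : ∀ {u v} → u ∼ v → merge u ≢ merge v → _~_ G/xy (merge u) (merge v)
  merge-edge {u} {v} u∼v mu≢mv with punchIn-merge u | punchIn-merge v
  ... | inj₁ refl | inj₁ refl = ⊥-elim (~-irr G u∼v)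
  ... | inj₁ refl | inj₂ eq = mu≢mv , inj₂ (inj₁ (punchIn-merge-y , subst (y ∼_) (sym eq) u∼v))
  ... | inj₂ eq | inj₁ refl =
    mu≢mv , inj₂ (inj₂ (punchIn-merge-y , subst (y ∼_) (sym eq) (~-sym G u∼v)))
  ... | inj₂ eq | inj₂ eq′ = mu≢mv , inj₁ (subst₂ _∼_ (sym eq) (sym eq′) u∼v)

  -- The preimage of S under merge.
  lift : Subset m → Subset (suc m)
  lift S = insertAt S y (lookup S x′)

  lookup-lift : ∀ S z → lookup (lift S) z ≡ lookup S (merge z)
  lookup-lift S z with punchIn-merge z
  ... | inj₁ refl = trans (insertAt-lookup S y _) (cong (lookup S) (sym merge-y))
  ... | inj₂ eq = begin
    lookup (lift S) z                      ≡⟨ cong (lookup (lift S)) eq ⟨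
    lookup (lift S) (punchIn y (merge z))  ≡⟨ insertAt-punchIn S y _ (merge z) ⟩
    lookup S (merge z)                     ∎
    where open ≡-Reasoning

  ∈-lift⁺ : ∀ {S z} → merge z ∈ S → z ∈ lift S
  ∈-lift⁺ {S} {z} mz∈S = lookup⇒[]= z (lift S) (trans (lookup-lift S z) ([]=⇒lookup mz∈S))

  ∈-lift⁻ : ∀ {S z} → z ∈ lift S → merge z ∈ S
  ∈-lift⁻ {S} {z} z∈S′ = lookup⇒[]= (merge z) S (trans (sym (lookup-lift S z)) ([]=⇒lookup z∈S′))

  x∈lift : ∀ {S} → x′ ∈ S → x ∈ lift S
  x∈lift {S} x′∈S = ∈-lift⁺ (subst (_∈ S) (sym merge-x) x′∈S)

  y∈lift : ∀ {S} → x′ ∈ S → y ∈ lift S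
  y∈lift {S} x′∈S = ∈-lift⁺ (subst (_∈ S) (sym merge-y) x′∈S)

  ∣lift∣ : ∀ S → ∣ lift S ∣ ≡ ∣ lookup S x′ ∷ S ∣
  ∣lift∣ S = ∣insertAt∣ S y (lookup S x′)

  ∣S∣≤∣lift∣ : ∀ S → ∣ S ∣ ≤ ∣ lift S ∣
  ∣S∣≤∣lift∣ S = subst (∣ S ∣ ≤_) (sym (∣lift∣ S)) (∣p∣≤∣x∷p∣ (lookup S x′) S)

  x′∉S⇒∣lift∣≡∣S∣ : ∀ {S} → x′ ∉ S → ∣ lift S ∣ ≡ ∣ S ∣
  x′∉S⇒∣lift∣≡∣S∣ {S} x′∉S =
    trans (∣lift∣ S) (cong (λ s → ∣ s ∷ S ∣) (¬-not (x′∉S ∘ lookup⇒[]= x′ S)))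

  x′∈S⇒∣lift-z∣≡∣S∣ : ∀ {S z} → x′ ∈ S → z ∈ lift S → ∣ lift S - z ∣ ≡ ∣ S ∣
  x′∈S⇒∣lift-z∣≡∣S∣ {S} x′∈S z∈S′ = suc-injective (begin
    suc ∣ lift S - _ ∣  ≡⟨ x∈p⇒suc∣p-x∣≡∣p∣ z∈S′ ⟩
    ∣ lift S ∣          ≡⟨ ∣lift∣ S ⟩
    ∣ lookup S x′ ∷ S ∣ ≡⟨ cong (λ s → ∣ s ∷ S ∣) ([]=⇒lookup x′∈S) ⟩
    suc ∣ S ∣           ∎)
    where open ≡-Reasoning

  merge-reach : ∀ {T u v} → Reach G (lift T) u v → Reach G/xy T (merge u) (merge v)
  merge-reach (here u∉T) = here (u∉T ∘ ∈-lift⁺)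
  merge-reach {T} (step {u} {w} u∉T u∼w w⇝v) with merge u ≟ merge w
  ... | yes eq = subst (λ s → Reach G/xy T s _) (sym eq) (merge-reach w⇝v)
  ... | no mu≢mw = step (u∉T ∘ ∈-lift⁺) (merge-edge u∼w mu≢mw) (merge-reach w⇝v)

  lift-IsCut : ∀ {T} → IsCut G/xy T → IsCut G (lift T)
  lift-IsCut {T} (u , v , u∉T , v∉T , ¬u⇝v) =
    punchIn y u , punchIn y v , punchIn∉lift u∉T , punchIn∉lift v∉T ,
    λ r → ¬u⇝v (subst₂ (Reach G/xy T) (merge-punchIn u) (merge-punchIn v) (merge-reach r))
    where
    punchIn∉lift : ∀ {i} → i ∉ T → punchIn y i ∉ lift T
    punchIn∉lift {i} i∉T = i∉T ∘ subst (_∈ T) (merge-punchIn i) ∘ ∈-lift⁻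

  lift-Separation : ∀ {T A B} → Separation G/xy T A B → Separation G (lift T) (lift A) (lift B)
  lift-Separation {A = A} {B} sep = mkSeparation
    (λ _ z∉T → map⊎ ∈-lift⁺ ∈-lift⁺ (cover _ (z∉T ∘ ∈-lift⁺)))
    (λ _ z∈A → A-avoids-T _ (∈-lift⁻ z∈A) ∘ ∈-lift⁻)
    (λ _ z∈B → B-avoids-T _ (∈-lift⁻ z∈B) ∘ ∈-lift⁻)
    (λ _ z∈A → disjoint _ (∈-lift⁻ z∈A) ∘ ∈-lift⁻)
    (λ _ _ u∈A v∈B u∼v → no-edge _ _ (∈-lift⁻ u∈A) (∈-lift⁻ v∈B) (merge-edge u∼v λ mu≡mv →
      disjoint _ (∈-lift⁻ u∈A) (subst (_∈ B) (sym mu≡mv) (∈-lift⁻ v∈B))))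
    (≤-trans 2≤∣A∣ (∣S∣≤∣lift∣ A))
    (≤-trans 2≤∣B∣ (∣S∣≤∣lift∣ B))
    where open Separation sep

  module _ (¬Straddles-both : ∀ {T} → x ∈ T → y ∈ T → Straddles G T x → Straddles G T y → ⊥) where

    contract-¬IsCut : ∀ {k} → (∀ T → ∣ T ∣ < k → ¬ IsCut G T) → ∀ T → ∣ T ∣ < k → ¬ IsCut G/xy T
    contract-¬IsCut {k} ¬cut T ∣T∣<k cut with x′ ∈? T
    ... | no x′∉T = ¬cut (lift T) (subst (_< k) (sym (x′∉S⇒∣lift∣≡∣S∣ x′∉T)) ∣T∣<k) (lift-IsCut cut)
    ... | yes x′∈T =
      minimal-cut⇒¬¬Straddles G (lift-IsCut cut) (¬cut _ (smaller x∈T)) λ x-straddles →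
      minimal-cut⇒¬¬Straddles G (lift-IsCut cut) (¬cut _ (smaller y∈T)) λ y-straddles →
      ¬Straddles-both x∈T y∈T x-straddles y-straddles
      where
      x∈T : x ∈ lift T
      x∈T = x∈lift x′∈T

      y∈T : y ∈ lift T
      y∈T = y∈lift x′∈T

      smaller : ∀ {z} → z ∈ lift T → ∣ lift T - z ∣ < k
      smaller z∈T = subst (_< k) (sym (x′∈S⇒∣lift-z∣≡∣S∣ x′∈T z∈T)) ∣T∣<k

    contract-¬NontrivialCut : ∀ {k nsx nsy} → Neighbourhood G x nsx → Neighbourhood G y nsy →
      (∀ T → ∣ T ∣ ≡ k → ¬ NontrivialCut G T) → ∀ T → ∣ T ∣ ≡ k → ¬ NontrivialCut G/xy T
    contract-¬NontrivialCut N[x] N[y] ¬nontrivial T ∣T∣≡k nontrivial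
      with NontrivialCut⇒Separation G/xy nontrivial | x′ ∈? T
    ... | _ , _ , sep | no x′∉T =
      ¬nontrivial (lift T) (trans (x′∉S⇒∣lift∣≡∣S∣ x′∉T) ∣T∣≡k)
        (Separation⇒NontrivialCut G (lift-Separation sep))
    ... | _ , _ , sep | yes x′∈T =
      ¬Straddles-both x∈T y∈T (straddles N[x] x∈T) (straddles N[y] y∈T)
      where
      x∈T : x ∈ lift T
      x∈T = x∈lift x′∈T

      y∈T : y ∈ lift T
      y∈T = y∈lift x′∈T

      straddles : ∀ {z ns} → Neighbourhood G z ns → z ∈ lift T → Straddles G (lift T) z
      straddles N z∈T = Separation⇒Straddles G (lift-Separation sep) N z∈T
        (¬nontrivial _ (trans (x′∈S⇒∣lift-z∣≡∣S∣ x′∈T z∈T) ∣T∣≡k))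

-- The configuration of the theorem

module _ {n : ℕ} (G : Graph n) {T : Subset n} where

  private
    _∼_ : Fin n → Fin n → Set
    _∼_ = _~_ G

  x₄∉T⇒¬Straddles : ∀ {x x₁ x₂ x₃ x₄} → Neighbourhood G x (x₁ ∷ x₂ ∷ x₃ ∷ x₄ ∷ []) →
                    x₁ ∼ x₄ → x₂ ∼ x₄ → x₃ ∈ T → x₄ ∉ T → ¬ Straddles G T x
  x₄∉T⇒¬Straddles {x} {x₄ = x₄} (N[x] , _) x₁∼x₄ x₂∼x₄ x₃∈T x₄∉T = hub⇒¬Straddles G x₄ via-x₄
    where
    via-x₄ : ∀ {p} → x ∼ p → p ∉ T → Reach G T p x₄
    via-x₄ x∼p p∉T with N[x] x∼p
    ... | here refl = step p∉T x₁∼x₄ (here x₄∉T)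
    ... | there (here refl) = step p∉T x₂∼x₄ (here x₄∉T)
    ... | there (there (here refl)) = contradiction x₃∈T p∉T
    ... | there (there (there (here refl))) = here x₄∉T
    ... | there (there (there (there ())))

  x₄∈T⇒¬Straddles : ∀ {x x₃ x₄ a b} → Neighbourhood G x₃ (x ∷ x₄ ∷ a ∷ b ∷ []) → a ∼ b →
                    x ∈ T → x₄ ∈ T → ¬ Straddles G T x₃
  x₄∈T⇒¬Straddles {x₃ = x₃} {a = a} {b} (N[x₃] , _) a∼b x∈T x₄∈T = clique⇒¬Straddles G ab-clique
    where
    on-ab : ∀ {p} → x₃ ∼ p → p ∉ T → p ≡ a ⊎ p ≡ b
    on-ab x₃∼p p∉T with N[x₃] x₃∼p
    ... | here refl = contradiction x∈T p∉T
    ... | there (here refl) = contradiction x₄∈T p∉T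
    ... | there (there (here refl)) = inj₁ refl
    ... | there (there (there (here refl))) = inj₂ refl
    ... | there (there (there (there ())))

    ab-clique : ∀ {p q} → x₃ ∼ p → x₃ ∼ q → p ∉ T → q ∉ T → p ≡ q ⊎ p ∼ q
    ab-clique x₃∼p x₃∼q p∉T q∉T with on-ab x₃∼p p∉T | on-ab x₃∼q q∉T
    ... | inj₁ refl | inj₁ refl = inj₁ refl
    ... | inj₁ refl | inj₂ refl = inj₂ a∼b
    ... | inj₂ refl | inj₁ refl = inj₂ (~-sym G a∼b)
    ... | inj₂ refl | inj₂ refl = inj₁ refl

  star-¬Straddles-both : ∀ {x x₁ x₂ x₃ x₄ a b} →
    Neighbourhood G x (x₁ ∷ x₂ ∷ x₃ ∷ x₄ ∷ []) → Neighbourhood G x₃ (x ∷ x₄ ∷ a ∷ b ∷ []) →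
    x₁ ∼ x₄ → x₂ ∼ x₄ → a ∼ b → x ∈ T → x₃ ∈ T → Straddles G T x → Straddles G T x₃ → ⊥
  star-¬Straddles-both {x₄ = x₄} N[x] N[x₃] x₁∼x₄ x₂∼x₄ a∼b x∈T x₃∈T x-straddles x₃-straddles
    with x₄ ∈? T
  ... | no x₄∉T = x₄∉T⇒¬Straddles N[x] x₁∼x₄ x₂∼x₄ x₃∈T x₄∉T x-straddles
  ... | yes x₄∈T = x₄∈T⇒¬Straddles N[x₃] a∼b x∈T x₄∈T x₃-straddles

≡⊎≡⊎≡⊎≡⇒∈ : ∀ {A : Set} {v a b c d : A} → v ≡ a ⊎ v ≡ b ⊎ v ≡ c ⊎ v ≡ d → v ∈ₗ a ∷ b ∷ c ∷ d ∷ []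
≡⊎≡⊎≡⊎≡⇒∈ (inj₁ v≡a) = here v≡a
≡⊎≡⊎≡⊎≡⇒∈ (inj₂ (inj₁ v≡b)) = there (here v≡b)
≡⊎≡⊎≡⊎≡⇒∈ (inj₂ (inj₂ (inj₁ v≡c))) = there (there (here v≡c))
≡⊎≡⊎≡⊎≡⇒∈ (inj₂ (inj₂ (inj₂ v≡d))) = there (there (there (here v≡d)))

lemma4 : ∀ (m : ℕ) (G : Graph (suc m)) → 14 ≤ suc m → QuasiConnected G 5 →
    ∀ (x x₁ x₂ x₃ x₄ a b : Fin (suc m)) →
    -- N(x) = {x₁, x₂, x₃, x₄} with x₁..x₄ distinct (so deg x = 4)
    x₁ ≢ x₂ → x₁ ≢ x₃ → x₁ ≢ x₄ → x₂ ≢ x₃ → x₂ ≢ x₄ → x₃ ≢ x₄ →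
    _~_ G x x₁ → _~_ G x x₂ → _~_ G x x₃ → _~_ G x x₄ →
    (∀ v → _~_ G x v → v ≡ x₁ ⊎ v ≡ x₂ ⊎ v ≡ x₃ ⊎ v ≡ x₄) →
    -- G[N(x)] is the star with edges x₁x₄, x₂x₄, x₃x₄
    _~_ G x₁ x₄ → _~_ G x₂ x₄ → _~_ G x₃ x₄ →
    ¬ (_~_ G x₁ x₂) → ¬ (_~_ G x₁ x₃) → ¬ (_~_ G x₂ x₃) →
    -- N(x₃) = {x, x₄, a, b} with these distinct (so deg x₃ = 4), and ab ∈ E(G)
    x ≢ a → x ≢ b → x₄ ≢ a → x₄ ≢ b → a ≢ b →
    _~_ G x₃ a → _~_ G x₃ b →
    (∀ v → _~_ G x₃ v → v ≡ x ⊎ v ≡ x₄ ⊎ v ≡ a ⊎ v ≡ b) →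
    _~_ G a b →
    QuasiConnected (contract G x x₃) 5
lemma4 m G 14≤1+m ((_ , ¬IsCut-small) , ¬NontrivialCut-4) x x₁ x₂ x₃ x₄ a b _ _ _ _ _ _
       x∼x₁ x∼x₂ x∼x₃ x∼x₄ N[x]-⊆ x₁∼x₄ x₂∼x₄ x₃∼x₄ _ _ _ _ _ _ _ _ x₃∼a x₃∼b N[x₃]-⊆ a∼b =
  (4<m , contract-¬IsCut ¬Straddles-both ¬IsCut-small) ,
  contract-¬NontrivialCut ¬Straddles-both N[x] N[x₃] ¬NontrivialCut-4
  where
  x₃≢x : x₃ ≢ x
  x₃≢x refl = ~-irr G x∼x₃

  open Contraction G x x₃ x₃≢x

  4<m : 4 < m
  4<m = ≤-trans (m≤n+m 5 8) (s≤s⁻¹ 14≤1+m)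

  N[x] : Neighbourhood G x (x₁ ∷ x₂ ∷ x₃ ∷ x₄ ∷ [])
  N[x] = (λ {v} x∼v → ≡⊎≡⊎≡⊎≡⇒∈ (N[x]-⊆ v x∼v)) , x∼x₁ ∷ x∼x₂ ∷ x∼x₃ ∷ x∼x₄ ∷ []

  N[x₃] : Neighbourhood G x₃ (x ∷ x₄ ∷ a ∷ b ∷ [])
  N[x₃] = (λ {v} x₃∼v → ≡⊎≡⊎≡⊎≡⇒∈ (N[x₃]-⊆ v x₃∼v)) , ~-sym G x∼x₃ ∷ x₃∼x₄ ∷ x₃∼a ∷ x₃∼b ∷ []

  ¬Straddles-both : ∀ {T} → x ∈ T → x₃ ∈ T → Straddles G T x → Straddles G T x₃ → ⊥
  ¬Straddles-both = star-¬Straddles-both G N[x] N[x₃] x₁∼x₄ x₂∼x₄ a∼b
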